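{- Let $n\ge 3$ and $1\le r\le\lfloor n/2\rfloor$ be integers and $G=\operatorname{Circ}(n,\{1,\dots,r\})$. Then the Wiener index of $G$ is \[W(G)=\frac n2 t(G)=\frac{n}{2}\left(\left\lfloor\frac{n-1}{2r}\right\rfloor+1\right)\left((n-1)-r\left\lfloor\frac{n-1}{2r}\right\rfloor\right).\]
   Context: For $n\ge3$ and $S\subseteq\mathbb Z_n\setminus\{0\}$, the circulant graph $\operatorname{Circ}(n,S)$ has vertex set $\mathbb Z_n$ and edges $ij$ whenever $i-j$ or $j-i$ lies in $S$. It is transmission regular: every vertex $v$ has the same transmission $t(v)=\sum_w d(v,w)$ (shortest-path distance), denoted $t(G)$. The Wiener index of a connected graph $G$ with vertices $v_1,\dots,v_n$ is $W(G)=\frac12\sum_{i=1}^n\sum_{j=1}^n d(v_i,v_j)$. -}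

module Defs where

open import Data.Nat using (ℕ; zero; suc; _+_; _*_; _∸_; _≤ᵇ_; _<ᵇ_; _≡ᵇ_)
open import Data.Nat.DivMod using (_/_)
open import Data.Bool using (Bool; true; false; _∧_; _∨_; if_then_else_)
open import Data.Fin using (Fin; toℕ)
open import Data.List using (List; map)
open import Data.Nat.ListAction using (sum)
open import Data.Bool.ListAction using (any)
open import Data.Fin.Base using ()
open import Data.List using (allFin)

-- Forward circular difference (j - i) mod n, for vertices i j of ℤ_n = Fin n,
-- computed without needing NonZero n.
circDiff : {n : ℕ} → Fin n → Fin n → ℕ
circDiff {n} i j = if toℕ i ≤ᵇ toℕ j then toℕ j ∸ toℕ i else n ∸ (toℕ i ∸ toℕ j)

inConn : ℕ → ℕ → Bool
inConn r d = (1 ≤ᵇ d) ∧ (d ≤ᵇ r)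

circAdj : (n r : ℕ) → Fin n → Fin n → Bool
circAdj n r i j = inConn r (circDiff i j) ∨ inConn r (circDiff j i)

-- Generic graph on vertex set Fin n given by a Boolean adjacency relation.
-- reach A k v w = true iff there is a walk of length ≤ k from v to w.
reach : {n : ℕ} → (Fin n → Fin n → Bool) → ℕ → Fin n → Fin n → Bool
reach {n} A zero    v w = toℕ v ≡ᵇ toℕ w
reach {n} A (suc k) v w = reach A k v w ∨ any (λ u → reach A k v u ∧ A u w) (allFin n)

-- least k ∈ {0,…,bound} with a walk of length ≤ k (returns bound if none);
-- search from k upward, with `fuel` remaining steps.
firstReach : {n : ℕ} → (Fin n → Fin n → Bool) → Fin n → Fin n → ℕ → ℕ → ℕ
firstReach A v w k zero       = k
firstReach A v w k (suc fuel) = if reach A k v w then k else firstReach A v w (suc k) fuel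

-- Shortest-path distance d(v,w) in a graph on n vertices (for a connected
-- graph every distance is ≤ n - 1 < n, so searching k = 0..n suffices).
dist : {n : ℕ} → (Fin n → Fin n → Bool) → Fin n → Fin n → ℕ
dist {n} A v w = firstReach A v w 0 n

transmission : {n : ℕ} → (Fin n → Fin n → Bool) → Fin n → ℕ
transmission {n} A v = sum (map (dist A v) (allFin n))

-- Wiener index W(G) = ½ Σ_v Σ_w d(v,w)   (the double sum is always even)
wiener : {n : ℕ} → (Fin n → Fin n → Bool) → ℕ
wiener {n} A = sum (map (transmission A) (allFin n)) / 2

-- floor division a / b for b ≥ 1 (value at b = 0 is irrelevant and set to 0)
divFloor : ℕ → ℕ → ℕ
divFloor a zero    = 0
divFloor a (suc b) = a / suc b

-- A walk of length at most ℓ leads from v to w exactly when the residue d = w − v (mod n)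
-- satisfies min(d, n − d) ≤ ℓ r: one edge moves the residue by at most r in either direction,
-- and a residue beyond ℓ r but within (ℓ + 1) r is brought within ℓ r by a single edge.
-- Hence d(v, w) = ⌈min(d, n − d) / r⌉, and as w ↦ w − v permutes ℤ_n, every vertex has
-- transmission t = Σ_{d<n} ⌈min(d, n − d) / r⌉.  Folding this symmetric sum leaves
-- 2 Σ_{i=1}^{k} ⌈i / r⌉ for n = 2k + 1, plus ⌈(k + 1) / r⌉ for n = 2k + 2.  For k = q r + s
-- with s < r the doubled sum is (q + 1)(q r + 2s), and q = ⌊(n − 1) / 2r⌋ gives the formula.
-- Summing the constant transmission over the n vertices gives 2 W = n t.

module Submission where

open import Defs
open import Data.Bool using (Bool; T; true; false; if_then_else_; _∧_)
open import Data.Bool.Properties using (T-∧; T-∨)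
open import Data.Fin using (Fin; toℕ; fromℕ<)
import Data.Fin as Fin
open import Data.Fin.Properties using (toℕ<n; toℕ-fromℕ<; toℕ-injective)
open import Data.List using (map; tabulate; allFin)
open import Data.List.Properties using (map-tabulate)
open import Data.List.Membership.Propositional using (lose)
open import Data.List.Membership.Propositional.Properties using (∈-allFin)
open import Data.List.Relation.Unary.Any using (satisfied)
open import Data.List.Relation.Unary.Any.Properties using (any⁺; any⁻)
open import Data.Nat using (ℕ; zero; suc; pred; _+_; _*_; _∸_; _⊓_; _≤_; _<_; _≤ᵇ_; z≤n; s≤s; s≤s⁻¹; z<s; s<s; NonZero; >-nonZero; >-nonZero⁻¹)
open import Data.Nat.Properties
open import Data.Nat.DivMod using (_/_; _%_; m≡m%n+[m/n]*n; m%n<n; m<n*o⇒m/o<n; +-distrib-/-∣ʳ; m<n⇒m/n≡0; m*n/n≡m; m*[n/m]≡n)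
open import Data.Nat.Divisibility using (_∣_; divides; n∣m*n; m∣m*n; ∣m⇒∣m*n; ∣n⇒∣m*n)
open import Data.Nat.ListAction using (sum)
open import Data.Nat.Tactic.RingSolver using (solve-∀)
open import Algebra.Properties.CommutativeSemigroup +-commutativeSemigroup using (interchange; xy∙z≈xz∙y)
open import Data.Product using (∃; _×_; _,_; proj₂)
open import Data.Sum using (_⊎_; inj₁; inj₂; [_,_])
import Data.Sum as Sum
open import Data.Unit using (tt)
open import Function using (_∘_; id; const)
open import Function.Bundles using (_⇔_; mk⇔; Equivalence)
open import Function.Properties.Equivalence using () renaming (trans to ⇔-trans; sym to ⇔-sym)
open import Relation.Binary.PropositionalEquality using (_≡_; _≢_; refl; sym; trans; cong; cong₂; subst; module ≡-Reasoning)
open import Relation.Nullary using (contradiction; yes; no)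
open import Relation.Nullary.Decidable using (_⊎-dec_)

sumBelow : ℕ → (ℕ → ℕ) → ℕ
sumBelow zero    f = 0
sumBelow (suc m) f = f 0 + sumBelow m (f ∘ suc)

sumBelow-cong : ∀ m {f g : ℕ → ℕ} → (∀ i → i < m → f i ≡ g i) → sumBelow m f ≡ sumBelow m g
sumBelow-cong zero    eq = refl
sumBelow-cong (suc m) eq = cong₂ _+_ (eq 0 z<s) (sumBelow-cong m (λ i i<m → eq (suc i) (s<s i<m)))

sumBelow-+ : ∀ m k f → sumBelow (m + k) f ≡ sumBelow m f + sumBelow k (λ i → f (m + i))
sumBelow-+ zero    k f = refl
sumBelow-+ (suc m) k f = trans (cong (f 0 +_) (sumBelow-+ m k (f ∘ suc))) (sym (+-assoc (f 0) _ _))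

sumBelow-suc : ∀ m f → sumBelow (suc m) f ≡ sumBelow m f + f m
sumBelow-suc m f = begin
  sumBelow (suc m) f                 ≡⟨ cong (λ k → sumBelow k f) (+-comm 1 m) ⟩
  sumBelow (m + 1) f                 ≡⟨ sumBelow-+ m 1 f ⟩
  sumBelow m f + (f (m + 0) + 0)     ≡⟨ cong (sumBelow m f +_) (trans (+-identityʳ _) (cong f (+-identityʳ m))) ⟩
  sumBelow m f + f m                 ∎
  where open ≡-Reasoning

sumBelow-reverse : ∀ m f → sumBelow m (λ i → f (m ∸ suc i)) ≡ sumBelow m f
sumBelow-reverse zero    f = refl
sumBelow-reverse (suc m) f = begin
  f m + sumBelow m (λ i → f (m ∸ suc i)) ≡⟨ cong (f m +_) (sumBelow-reverse m f) ⟩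
  f m + sumBelow m f                     ≡⟨ +-comm (f m) _ ⟩
  sumBelow m f + f m                     ≡⟨ sumBelow-suc m f ⟨
  sumBelow (suc m) f                     ∎
  where open ≡-Reasoning

sumBelow-const : ∀ m c → sumBelow m (const c) ≡ m * c
sumBelow-const zero    c = refl
sumBelow-const (suc m) c = cong (c +_) (sumBelow-const m c)

sum-tabulate : ∀ n {g : Fin n → ℕ} {f : ℕ → ℕ} → (∀ w → g w ≡ f (toℕ w)) →
               sum (tabulate g) ≡ sumBelow n f
sum-tabulate zero    eq = refl
sum-tabulate (suc n) eq = cong₂ _+_ (eq Fin.zero) (sum-tabulate n (eq ∘ Fin.suc))

sum-map-allFin : ∀ n {g : Fin n → ℕ} {f : ℕ → ℕ} → (∀ w → g w ≡ f (toℕ w)) →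
                 sum (map g (allFin n)) ≡ sumBelow n f
sum-map-allFin n {g} eq = trans (cong sum (map-tabulate id g)) (sum-tabulate n eq)

record Shift (n a e b : ℕ) : Set where
  constructor shift
  field
    multiple : ℕ
    shift-eq : a + e ≡ b + multiple * n

Shift-trans : ∀ {n a b c x y} → Shift n a x b → Shift n b y c → Shift n a (x + y) c
Shift-trans {n} {a} {b} {c} {x} {y} (shift i p) (shift j q) = shift (j + i) (begin
  a + (x + y)         ≡⟨ +-assoc a x y ⟨
  a + x + y           ≡⟨ cong (_+ y) p ⟩
  b + i * n + y       ≡⟨ xy∙z≈xz∙y b (i * n) y ⟩
  b + y + i * n       ≡⟨ cong (_+ i * n) q ⟩
  c + j * n + i * n   ≡⟨ +-assoc c (j * n) (i * n) ⟩
  c + (j * n + i * n) ≡⟨ cong (c +_) (*-distribʳ-+ n j i) ⟨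
  c + (j + i) * n     ∎)
  where open ≡-Reasoning

multiple-≤ : ∀ {n b c i j} → b < n → c + i * n ≡ b + j * n → i ≤ j
multiple-≤ {n} {b} {c} {i} {j} b<n p = s≤s⁻¹ (*-cancelʳ-< n i (suc j) (begin-strict
  i * n     ≤⟨ m≤n+m (i * n) c ⟩
  c + i * n ≡⟨ p ⟩
  b + j * n <⟨ +-monoˡ-< (j * n) b<n ⟩
  suc j * n ∎))
  where open ≤-Reasoning

shift-multiple-≤ : ∀ {n a b e e′ i j} → e′ < n → a + e ≡ b + i * n → a + e′ ≡ b + j * n → j ≤ i
shift-multiple-≤ {n} {a} {b} {e} {e′} {i} {j} e′<n p q = ≮⇒≥ λ i<j → <-irrefl refl (begin-strict
  a + e′            <⟨ +-monoʳ-< a e′<n ⟩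
  a + n             ≤⟨ +-monoˡ-≤ n (m≤m+n a e) ⟩
  a + e + n         ≡⟨ cong (_+ n) p ⟩
  b + i * n + n     ≡⟨ +-assoc b (i * n) n ⟩
  b + (i * n + n)   ≡⟨ cong (b +_) (+-comm (i * n) n) ⟩
  b + suc i * n     ≤⟨ +-monoʳ-≤ b (*-monoˡ-≤ n i<j) ⟩
  b + j * n         ≡⟨ q ⟨
  a + e′            ∎)
  where open ≤-Reasoning

Shift-unique : ∀ {n a b e e′} → e < n → e′ < n → Shift n a e b → Shift n a e′ b → e ≡ e′
Shift-unique {n} {a} e<n e′<n (shift i p) (shift j q)
  with refl ← ≤-antisym (shift-multiple-≤ {i = j} {j = i} e<n q p) (shift-multiple-≤ {i = i} {j = j} e′<n p q)
  =  +-cancelˡ-≡ a _ _ (trans p (sym q))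

Shift-cancel-multiple : ∀ {n a b e} i → b < n → Shift n a (e + i * n) b → Shift n a e b
Shift-cancel-multiple {n} {a} {b} {e} i b<n (shift j p)
  with d , refl ← m≤n⇒∃[o]m+o≡n (multiple-≤ {c = a + e} {i = i} {j = j} b<n (trans (+-assoc a e (i * n)) p))
  = shift d (+-cancelʳ-≡ (i * n) _ _ (begin
  a + e + i * n     ≡⟨ +-assoc a e (i * n) ⟩
  a + (e + i * n)   ≡⟨ p ⟩
  b + (i + d) * n   ≡⟨ rearrange b i d n ⟩
  b + d * n + i * n ∎))
  where
  open ≡-Reasoning
  rearrange : ∀ b i d n → b + (i + d) * n ≡ b + d * n + i * n
  rearrange = solve-∀

Shift-split : ∀ {n a b} s t → b < n → Shift n a (s + t) b →
              ∃ λ u → u < n × Shift n a s u × Shift n u t b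
Shift-split {n} {a} {b} s t b<n (shift j p) =
  u , m%n<n (a + s) n , shift q (m≡m%n+[m/n]*n (a + s) n) , Shift-cancel-multiple q b<n (shift j (begin
    u + (t + q * n) ≡⟨ rearrange u t (q * n) ⟩
    u + q * n + t   ≡⟨ cong (_+ t) (m≡m%n+[m/n]*n (a + s) n) ⟨
    a + s + t       ≡⟨ +-assoc a s t ⟩
    a + (s + t)     ≡⟨ p ⟩
    b + j * n       ∎))
  where
  instance
    n≢0 : NonZero n
    n≢0 = >-nonZero (<-≤-trans z<s b<n)
  u = (a + s) % n
  q = (a + s) / n
  open ≡-Reasoning
  rearrange : ∀ u t m → u + (t + m) ≡ u + m + t
  rearrange = solve-∀

-- circDiff i j is definitionally cdiff n (toℕ i) (toℕ j).
cdiff : ℕ → ℕ → ℕ → ℕ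
cdiff n a b = if a ≤ᵇ b then b ∸ a else n ∸ (a ∸ b)

cdiff-cases : ∀ n a b → (a ≤ b × cdiff n a b ≡ b ∸ a) ⊎ (b < a × cdiff n a b ≡ n ∸ (a ∸ b))
cdiff-cases n a b with a ≤ᵇ b in eq
... | true  = inj₁ (≤ᵇ⇒≤ a b (subst T (sym eq) tt) , refl)
... | false = inj₂ (≰⇒> (λ a≤b → subst T eq (≤⇒≤ᵇ a≤b)) , refl)

cdiff-shift : ∀ {n a} b → a < n → Shift n a (cdiff n a b) b
cdiff-shift {n} {a} b a<n with cdiff-cases n a b
... | inj₁ (a≤b , eq) = shift 0 (begin
  a + cdiff n a b ≡⟨ cong (a +_) eq ⟩
  a + (b ∸ a)     ≡⟨ m+[n∸m]≡n a≤b ⟩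
  b               ≡⟨ +-identityʳ b ⟨
  b + 0 * n       ∎)
  where open ≡-Reasoning
... | inj₂ (b<a , eq) = shift 1 (begin
  a + cdiff n a b               ≡⟨ cong (a +_) eq ⟩
  a + (n ∸ (a ∸ b))             ≡⟨ cong (_+ (n ∸ (a ∸ b))) (m+[n∸m]≡n (<⇒≤ b<a)) ⟨
  b + (a ∸ b) + (n ∸ (a ∸ b))   ≡⟨ +-assoc b _ _ ⟩
  b + ((a ∸ b) + (n ∸ (a ∸ b))) ≡⟨ cong (b +_) (m+[n∸m]≡n (≤-trans (m∸n≤m a b) (<⇒≤ a<n))) ⟩
  b + n                         ≡⟨ cong (b +_) (+-identityʳ n) ⟨
  b + 1 * n                     ∎)
  where open ≡-Reasoning

cdiff<n : ∀ {n a b} → a < n → b < n → cdiff n a b < n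
cdiff<n {n} {a} {b} a<n b<n with cdiff-cases n a b
... | inj₁ (_ , eq)   = subst (_< n) (sym eq) (≤-<-trans (m∸n≤m b a) b<n)
... | inj₂ (b<a , eq) =
  subst (_< n) (sym eq) (∸-monoʳ-< {o = 0} (m<n⇒0<n∸m b<a) (≤-trans (m∸n≤m a b) (<⇒≤ a<n)))

cdiff-unique : ∀ {n a b e} → a < n → b < n → e < n → Shift n a e b → cdiff n a b ≡ e
cdiff-unique {b = b} a<n b<n e<n = Shift-unique (cdiff<n a<n b<n) e<n (cdiff-shift b a<n)

cdiff-reduce : ∀ {n a b e} → a < n → b < n → e < n + n → Shift n a e b →
               e ≡ cdiff n a b ⊎ e ≡ cdiff n a b + n
cdiff-reduce {n} {a} {b} {e} a<n b<n e<2n sh with e <? n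
... | yes e<n = inj₁ (sym (cdiff-unique a<n b<n e<n sh))
... | no e≮n = inj₂ (begin
  e            ≡⟨ w+n≡e ⟨
  e ∸ n + n    ≡⟨ cong (_+ n) (cdiff-unique a<n b<n w<n shift-w) ⟨
  cdiff n a b + n ∎)
  where
  open ≡-Reasoning
  w+n≡e : e ∸ n + n ≡ e
  w+n≡e = m∸n+n≡m (≮⇒≥ e≮n)
  w<n : e ∸ n < n
  w<n = +-cancelʳ-< n _ n (subst (_< n + n) (sym w+n≡e) e<2n)
  shift-w : Shift n a (e ∸ n) b
  shift-w = Shift-cancel-multiple 1 b<n
              (subst (λ e′ → Shift n a e′ b) (trans (sym w+n≡e) (cong (e ∸ n +_) (sym (+-identityʳ n)))) sh)

-- The residue d < n lies within m of 0 around the n-cycle.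
Near : ℕ → ℕ → ℕ → Set
Near n d m = d ≤ m ⊎ n ≤ d + m

Near-mono : ∀ {n d m m′} → m ≤ m′ → Near n d m → Near n d m′
Near-mono m≤m′ (inj₁ d≤m)           = inj₁ (≤-trans d≤m m≤m′)
Near-mono {d = d} m≤m′ (inj₂ n≤d+m) = inj₂ (≤-trans n≤d+m (+-monoʳ-≤ d m≤m′))

Near-zero : ∀ {n d} → d < n → Near n d 0 → d ≡ 0
Near-zero _   (inj₁ d≤0)   = n≤0⇒n≡0 d≤0
Near-zero d<n (inj₂ n≤d+0) = contradiction (subst (_ ≤_) (+-identityʳ _) n≤d+0) (<⇒≱ d<n)

Near-triangle : ∀ {n x y z p q} → x ≤ n → y ≤ n → x + y ≡ z ⊎ x + y ≡ z + n →
                Near n x p → Near n y q → Near n z (p + q)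
Near-triangle {n} {x} {y} {z} {p} {q} _ _ (inj₁ refl) = add
  where
  add : Near n x p → Near n y q → Near n (x + y) (p + q)
  add (inj₁ x≤p) (inj₁ y≤q) = inj₁ (+-mono-≤ x≤p y≤q)
  add (inj₂ n≤x+p) _        = inj₂ (≤-trans n≤x+p (+-mono-≤ (m≤m+n x y) (m≤m+n p q)))
  add _ (inj₂ n≤y+q)        = inj₂ (≤-trans n≤y+q (+-mono-≤ (m≤n+m y x) (m≤n+m q p)))
Near-triangle {n} {x} {y} {z} {p} {q} x≤n y≤n (inj₂ wrap) = add
  where
  z≤x : z ≤ x
  z≤x = +-cancelʳ-≤ n z x (subst (_≤ x + n) wrap (+-monoʳ-≤ x y≤n))
  z≤y : z ≤ y
  z≤y = +-cancelʳ-≤ n z y (subst (_≤ y + n) wrap (subst (x + y ≤_) (+-comm n y) (+-monoˡ-≤ y x≤n)))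
  add : Near n x p → Near n y q → Near n z (p + q)
  add (inj₁ x≤p) _ = inj₁ (≤-trans z≤x (≤-trans x≤p (m≤m+n p q)))
  add _ (inj₁ y≤q) = inj₁ (≤-trans z≤y (≤-trans y≤q (m≤n+m q p)))
  add (inj₂ n≤x+p) (inj₂ n≤y+q) = inj₂ (+-cancelʳ-≤ n n (z + (p + q)) (begin
    n + n               ≤⟨ +-mono-≤ n≤x+p n≤y+q ⟩
    x + p + (y + q)     ≡⟨ interchange x p y q ⟩
    x + y + (p + q)     ≡⟨ cong (_+ (p + q)) wrap ⟩
    z + n + (p + q)     ≡⟨ xy∙z≈xz∙y z n (p + q) ⟩
    z + (p + q) + n     ∎))
    where open ≤-Reasoning

cycNorm : ℕ → ℕ → ℕ
cycNorm n d = d ⊓ (n ∸ d)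

Near⇔cycNorm≤ : ∀ {n d m} → Near n d m ⇔ cycNorm n d ≤ m
Near⇔cycNorm≤ {n} {d} {m} = mk⇔ to from
  where
  to : Near n d m → cycNorm n d ≤ m
  to (inj₁ d≤m)   = m≤n⇒m⊓o≤n (n ∸ d) d≤m
  to (inj₂ n≤d+m) = m≤n⇒o⊓m≤n d (m≤n+o⇒m∸n≤o n d n≤d+m)
  from : cycNorm n d ≤ m → Near n d m
  from h with ≤-total d (n ∸ d)
  ... | inj₁ d≤n-d = inj₁ (subst (_≤ m) (m≤n⇒m⊓n≡m d≤n-d) h)
  ... | inj₂ n-d≤d = inj₂ (≤-trans (m≤n+m∸n n d) (+-monoʳ-≤ d (subst (_≤ m) (m≥n⇒m⊓n≡n n-d≤d) h)))

module _ {n : ℕ} where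

  circDiff-shift : (i j : Fin n) → Shift n (toℕ i) (circDiff i j) (toℕ j)
  circDiff-shift i j = cdiff-shift (toℕ j) (toℕ<n i)

  circDiff<n : (i j : Fin n) → circDiff i j < n
  circDiff<n i j = cdiff<n (toℕ<n i) (toℕ<n j)

  circDiff-unique : ∀ (i j : Fin n) {e} → e < n → Shift n (toℕ i) e (toℕ j) → circDiff i j ≡ e
  circDiff-unique i j = cdiff-unique (toℕ<n i) (toℕ<n j)

  circDiff-self : (i : Fin n) → circDiff i i ≡ 0
  circDiff-self i = circDiff-unique i i (≤-<-trans z≤n (toℕ<n i)) (shift 0 refl)

  circDiff≡0⇒≡ : (i j : Fin n) → circDiff i j ≡ 0 → i ≡ j
  circDiff≡0⇒≡ i j eq with circDiff-shift i j
  ... | shift k p rewrite eq with n≤0⇒n≡0 (multiple-≤ {i = k} {j = 0} (toℕ<n i) (sym p))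
  ... | refl = toℕ-injective (trans (sym (+-identityʳ (toℕ i))) (trans p (+-identityʳ (toℕ j))))

  circDiff-additive : (i j k : Fin n) →
    circDiff i j + circDiff j k ≡ circDiff i k ⊎ circDiff i j + circDiff j k ≡ circDiff i k + n
  circDiff-additive i j k =
    cdiff-reduce (toℕ<n i) (toℕ<n k) (+-mono-< (circDiff<n i j) (circDiff<n j k))
                 (Shift-trans (circDiff-shift i j) (circDiff-shift j k))

  circDiff-flip : (i j : Fin n) → i ≢ j → circDiff i j + circDiff j i ≡ n
  circDiff-flip i j i≢j with circDiff-additive i j i
  ... | inj₂ eq = trans eq (cong (_+ n) (circDiff-self i))
  ... | inj₁ eq = contradiction (circDiff≡0⇒≡ i j (m+n≡0⇒m≡0 _ (trans eq (circDiff-self i)))) i≢j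

  circDiff-split : (i j : Fin n) → ∀ s t → circDiff i j ≡ s + t →
                   ∃ λ u → circDiff i u ≡ s × circDiff u j ≡ t
  circDiff-split i j s t eq
    with u , u<n , sh₁ , sh₂ ← Shift-split s t (toℕ<n j)
                                  (subst (λ e → Shift n (toℕ i) e (toℕ j)) eq (circDiff-shift i j))
    = fromℕ< u<n
    , circDiff-unique i _ s<n (subst (Shift n (toℕ i) s) (sym (toℕ-fromℕ< u<n)) sh₁)
    , circDiff-unique _ j t<n (subst (λ v → Shift n v t (toℕ j)) (sym (toℕ-fromℕ< u<n)) sh₂)
    where
    s+t<n : s + t < n
    s+t<n = subst (_< n) eq (circDiff<n i j)
    s<n : s < n
    s<n = ≤-<-trans (m≤m+n s t) s+t<n
    t<n : t < n
    t<n = ≤-<-trans (m≤n+m t s) s+t<n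

  Near-from-reverse : (i j : Fin n) → ∀ {m} → circDiff j i ≤ m → Near n (circDiff i j) m
  Near-from-reverse i j {m} h with i Fin.≟ j
  ... | yes refl = inj₁ (subst (_≤ m) (sym (circDiff-self i)) z≤n)
  ... | no i≢j   = inj₂ (subst (_≤ circDiff i j + m) (circDiff-flip i j i≢j) (+-monoʳ-≤ (circDiff i j) h))

detour-lengths : ∀ {r m e} → 1 ≤ r → m < e → e ≤ r + m → (1 ≤ r ⊓ e × r ⊓ e ≤ r) × e ∸ r ≤ m
detour-lengths {r} {m} {e} r≥1 m<e e≤r+m =
  (⊓-glb r≥1 (≤-trans (s≤s z≤n) m<e) , m⊓n≤m r e) , m≤n+o⇒m∸n≤o e r e≤r+m

T-inConn : ∀ {r d} → T (inConn r d) ⇔ (1 ≤ d × d ≤ r)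
T-inConn {r} {d} = mk⇔
  (λ t → let t₁ , t₂ = Equivalence.to T-∧ t in ≤ᵇ⇒≤ 1 d t₁ , ≤ᵇ⇒≤ d r t₂)
  (λ (1≤d , d≤r) → Equivalence.from T-∧ (≤⇒≤ᵇ 1≤d , ≤⇒≤ᵇ d≤r))

module _ {n r : ℕ} where

  Adj : Fin n → Fin n → Bool
  Adj = circAdj n r

  T-circAdj : (u w : Fin n) →
              T (Adj u w) ⇔ ((1 ≤ circDiff u w × circDiff u w ≤ r) ⊎ (1 ≤ circDiff w u × circDiff w u ≤ r))
  T-circAdj u w = mk⇔
    (Sum.map (Equivalence.to T-inConn) (Equivalence.to T-inConn) ∘ Equivalence.to T-∨)
    (Equivalence.from (T-∨ {inConn r (circDiff u w)})
      ∘ Sum.map (Equivalence.from T-inConn) (Equivalence.from T-inConn))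

  circAdj⇒Near : (u w : Fin n) → T (Adj u w) → Near n (circDiff u w) r
  circAdj⇒Near u w = [ inj₁ ∘ proj₂ , Near-from-reverse u w ∘ proj₂ ] ∘ Equivalence.to (T-circAdj u w)

  reach-step : ∀ k (v u w : Fin n) → T (reach Adj k v u) → T (Adj u w) → T (reach Adj (suc k) v w)
  reach-step k v u w vu uw = Equivalence.from (T-∨ {reach Adj k v w}) (inj₂
    (any⁺ (λ u → reach Adj k v u ∧ Adj u w) (lose (∈-allFin u) (Equivalence.from T-∧ (vu , uw)))))

  reach-last-step : ∀ k (v w : Fin n) → T (reach Adj (suc k) v w) →
                    T (reach Adj k v w) ⊎ ∃ λ u → T (reach Adj k v u) × T (Adj u w)
  reach-last-step k v w t with Equivalence.to (T-∨ {reach Adj k v w}) t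
  ... | inj₁ vw = inj₁ vw
  ... | inj₂ t′ with u , vuw ← satisfied (any⁻ (λ u → reach Adj k v u ∧ Adj u w) (allFin n) t′)
    = inj₂ (u , Equivalence.to T-∧ vuw)

  reach⇒Near : ∀ k (v w : Fin n) → T (reach Adj k v w) → Near n (circDiff v w) (k * r)
  reach⇒Near zero v w t with toℕ-injective (≡ᵇ⇒≡ (toℕ v) (toℕ w) t)
  ... | refl = inj₁ (≤-reflexive (circDiff-self v))
  reach⇒Near (suc k) v w t with reach-last-step k v w t
  ... | inj₁ vw = Near-mono (m≤n+m (k * r) r) (reach⇒Near k v w vw)
  ... | inj₂ (u , vu , uw) = subst (Near n (circDiff v w)) (+-comm (k * r) r)
          (Near-triangle (<⇒≤ (circDiff<n v u)) (<⇒≤ (circDiff<n u w)) (circDiff-additive v u w)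
                         (reach⇒Near k v u vu) (circAdj⇒Near u w uw))

  -- The last edge covers r ⊓ d of the residue d, the walk before it the remaining d ∸ r.
  detour-forward : 1 ≤ r → ∀ {m} (v w : Fin n) → m < circDiff v w → circDiff v w ≤ r + m →
                   ∃ λ u → Near n (circDiff v u) m × T (Adj u w)
  detour-forward r≥1 v w m<d d≤r+m =
    let u , vu , uw   = circDiff-split v w (d ∸ r) (r ⊓ d) (sym (trans (+-comm (d ∸ r) _) (m⊓n+n∸m≡n r d)))
        edge , short = detour-lengths r≥1 m<d d≤r+m
    in u , inj₁ (subst (_≤ _) (sym vu) short)
         , Equivalence.from (T-circAdj u w) (inj₁ (subst (λ x → 1 ≤ x × x ≤ r) (sym uw) edge))
    where d = circDiff v w

  detour-backward : 1 ≤ r → ∀ {m} (v w : Fin n) → m < circDiff w v → circDiff w v ≤ r + m →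
                    ∃ λ u → Near n (circDiff v u) m × T (Adj u w)
  detour-backward r≥1 v w m<e e≤r+m =
    let u , wu , uv   = circDiff-split w v (r ⊓ e) (e ∸ r) (sym (m⊓n+n∸m≡n r e))
        edge , short = detour-lengths r≥1 m<e e≤r+m
    in u , Near-from-reverse v u (subst (_≤ _) (sym uv) short)
         , Equivalence.from (T-circAdj u w) (inj₂ (subst (λ x → 1 ≤ x × x ≤ r) (sym wu) edge))
    where e = circDiff w v

  Near⇒reach : 1 ≤ r → ∀ k (v w : Fin n) → Near n (circDiff v w) (k * r) → T (reach Adj k v w)
  Near⇒reach _ zero v w near =
    ≡⇒≡ᵇ (toℕ v) (toℕ w) (cong toℕ (circDiff≡0⇒≡ v w (Near-zero (circDiff<n v w) near)))
  Near⇒reach r≥1 (suc k) v w near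
    with (circDiff v w ≤? k * r) ⊎-dec (n ≤? circDiff v w + k * r)
  ... | yes near′ = Equivalence.from (T-∨ {reach Adj k v w}) (inj₁ (Near⇒reach r≥1 k v w near′))
  ... | no far = let u , vu , uw = detour near in reach-step k v u w (Near⇒reach r≥1 k v u vu) uw
    where
    d = circDiff v w
    e = circDiff w v
    kr<d : k * r < d
    kr<d = ≰⇒> (far ∘ inj₁)
    d+e≡n : d + e ≡ n
    d+e≡n = circDiff-flip v w λ { refl → far (inj₁ (subst (_≤ k * r) (sym (circDiff-self v)) z≤n)) }
    kr<e : k * r < e
    kr<e = +-cancelˡ-< d _ _ (subst (d + k * r <_) (sym d+e≡n) (≰⇒> (far ∘ inj₂)))
    detour : Near n d (r + k * r) → ∃ λ u → Near n (circDiff v u) (k * r) × T (Adj u w)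
    detour (inj₁ d≤r+kr)   = detour-forward r≥1 v w kr<d d≤r+kr
    detour (inj₂ n≤d+r+kr) = detour-backward r≥1 v w kr<e
      (+-cancelˡ-≤ d _ _ (subst (_≤ d + (r + k * r)) (sym d+e≡n) n≤d+r+kr))

  reach⇔Near : 1 ≤ r → ∀ k (v w : Fin n) → T (reach Adj k v w) ⇔ Near n (circDiff v w) (k * r)
  reach⇔Near r≥1 k v w = mk⇔ (reach⇒Near k v w) (Near⇒reach r≥1 k v w)

⌈_/_⌉ : ℕ → (r : ℕ) .{{_ : NonZero r}} → ℕ
⌈ x / r ⌉ = (x + pred r) / r

⌈/⌉≤⇔ : ∀ x r k .{{_ : NonZero r}} → ⌈ x / r ⌉ ≤ k ⇔ x ≤ k * r
⌈/⌉≤⇔ x r k = mk⇔ to from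
  where
  open ≤-Reasoning
  to : ⌈ x / r ⌉ ≤ k → x ≤ k * r
  to h = +-cancelʳ-≤ (pred r) x (k * r) (begin
    x + pred r                        ≡⟨ m≡m%n+[m/n]*n (x + pred r) r ⟩
    (x + pred r) % r + ⌈ x / r ⌉ * r  ≤⟨ +-mono-≤ rem≤pred (*-monoˡ-≤ r h) ⟩
    pred r + k * r                    ≡⟨ +-comm (pred r) (k * r) ⟩
    k * r + pred r                    ∎)
    where
    rem≤pred : (x + pred r) % r ≤ pred r
    rem≤pred = s≤s⁻¹ (subst ((x + pred r) % r <_) (sym (suc-pred r)) (m%n<n (x + pred r) r))
  from : x ≤ k * r → ⌈ x / r ⌉ ≤ k
  from h = s≤s⁻¹ (m<n*o⇒m/o<n (begin-strict
    x + pred r      ≤⟨ +-monoˡ-≤ (pred r) h ⟩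
    k * r + pred r  <⟨ +-monoʳ-< (k * r) (subst (pred r <_) (suc-pred r) ≤-refl) ⟩
    k * r + r       ≡⟨ +-comm (k * r) r ⟩
    suc k * r       ∎))

⌈/⌉≤id : ∀ x r .{{_ : NonZero r}} → ⌈ x / r ⌉ ≤ x
⌈/⌉≤id x r = Equivalence.from (⌈/⌉≤⇔ x r x) (m≤m*n x r)

⌈0/r⌉≡0 : ∀ r .{{_ : NonZero r}} → ⌈ 0 / r ⌉ ≡ 0
⌈0/r⌉≡0 r = n≤0⇒n≡0 (⌈/⌉≤id 0 r)

⌈[1+qr+s]/r⌉≡1+q : ∀ q s r .{{_ : NonZero r}} → s < r → ⌈ suc (q * r + s) / r ⌉ ≡ suc q
⌈[1+qr+s]/r⌉≡1+q q s r s<r = ≤-antisym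
  (Equivalence.from (⌈/⌉≤⇔ _ r (suc q)) (subst (suc (q * r + s) ≤_) (+-comm (q * r) r) (+-monoʳ-< (q * r) s<r)))
  (≰⇒> λ h → <⇒≱ (s≤s (m≤m+n (q * r) s)) (Equivalence.to (⌈/⌉≤⇔ _ r q) h))

module _ {n : ℕ} (G : Fin n → Fin n → Bool) (v w : Fin n) {c : ℕ}
         (reach⇔ : ∀ j → T (reach G j v w) ⇔ c ≤ j) where

  firstReach-≡ : ∀ k fuel → k ≤ c → c ≤ fuel + k → firstReach G v w k fuel ≡ c
  firstReach-≡ k zero    k≤c c≤k = ≤-antisym k≤c c≤k
  firstReach-≡ k (suc fuel) k≤c c≤fuel+k with reach G k v w in eq
  ... | true  = ≤-antisym k≤c (Equivalence.to (reach⇔ k) (subst T (sym eq) tt))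
  ... | false = firstReach-≡ (suc k) fuel (≰⇒> λ c≤k → subst T eq (Equivalence.from (reach⇔ k) c≤k))
                  (subst (c ≤_) (sym (+-suc fuel k)) c≤fuel+k)

  dist-≡ : c ≤ n → dist G v w ≡ c
  dist-≡ c≤n = firstReach-≡ 0 n z≤n (subst (c ≤_) (sym (+-identityʳ n)) c≤n)

dist-circAdj : ∀ {n} r .{{_ : NonZero r}} (v w : Fin n) →
               dist (circAdj n r) v w ≡ ⌈ cycNorm n (circDiff v w) / r ⌉
dist-circAdj {n} r v w = dist-≡ (circAdj n r) v w reach⇔ (begin
    ⌈ cycNorm n d / r ⌉ ≤⟨ ⌈/⌉≤id _ r ⟩
    cycNorm n d         ≤⟨ m⊓n≤m d (n ∸ d) ⟩
    d                   <⟨ circDiff<n v w ⟩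
    n                   ∎)
  where
  open ≤-Reasoning
  d = circDiff v w
  reach⇔ : ∀ j → T (reach (circAdj n r) j v w) ⇔ ⌈ cycNorm n d / r ⌉ ≤ j
  reach⇔ j = ⇔-trans (reach⇔Near (>-nonZero⁻¹ r) j v w)
                     (⇔-trans Near⇔cycNorm≤ (⇔-sym (⌈/⌉≤⇔ _ r j)))

sumBelow-rotate : ∀ {n a} → a < n → ∀ f → sumBelow n (λ b → f (cdiff n a b)) ≡ sumBelow n f
sumBelow-rotate {n} {a} a<n f = begin
  sumBelow n (f ∘ cdiff n a)                              ≡⟨ cong (λ k → sumBelow k (f ∘ cdiff n a)) a+m≡n ⟨
  sumBelow (a + m) (f ∘ cdiff n a)                        ≡⟨ sumBelow-+ a m (f ∘ cdiff n a) ⟩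
  sumBelow a (f ∘ cdiff n a) + sumBelow m (λ i → f (cdiff n a (a + i)))
                                                          ≡⟨ cong₂ _+_ (sumBelow-cong a below) (sumBelow-cong m above) ⟩
  sumBelow a (λ i → f (m + i)) + sumBelow m f             ≡⟨ +-comm _ (sumBelow m f) ⟩
  sumBelow m f + sumBelow a (λ i → f (m + i))             ≡⟨ sumBelow-+ m a f ⟨
  sumBelow (m + a) f                                      ≡⟨ cong (λ k → sumBelow k f) (trans (+-comm m a) a+m≡n) ⟩
  sumBelow n f                                            ∎
  where
  open ≡-Reasoning
  m = n ∸ a
  a+m≡n : a + m ≡ n
  a+m≡n = m+[n∸m]≡n (<⇒≤ a<n)
  below : ∀ i → i < a → f (cdiff n a i) ≡ f (m + i)
  below i i<a = cong f (cdiff-unique a<n (<-trans i<a a<n)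
                  (subst (m + i <_) (trans (+-comm m a) a+m≡n) (+-monoʳ-< m i<a))
                  (shift 1 (begin
                    a + (m + i) ≡⟨ +-assoc a m i ⟨
                    a + m + i   ≡⟨ cong (_+ i) a+m≡n ⟩
                    n + i       ≡⟨ +-comm n i ⟩
                    i + n       ≡⟨ cong (i +_) (+-identityʳ n) ⟨
                    i + 1 * n   ∎)))
  above : ∀ i → i < m → f (cdiff n a (a + i)) ≡ f i
  above i i<m = cong f (cdiff-unique a<n (subst (a + i <_) a+m≡n (+-monoʳ-< a i<m)) (<-≤-trans i<m (m∸n≤m n a))
                  (shift 0 (sym (+-identityʳ (a + i)))))

transmission-circAdj : ∀ {n} r .{{_ : NonZero r}} (v : Fin n) →
                       transmission (circAdj n r) v ≡ sumBelow n (λ d → ⌈ cycNorm n d / r ⌉)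
transmission-circAdj {n} r v =
  trans (sum-map-allFin n (dist-circAdj r v)) (sumBelow-rotate (toℕ<n v) (λ d → ⌈ cycNorm n d / r ⌉))

-- For n = 1 + c + 2k with c ∈ {0, 1}, the residues 1 + i (i < k) and their mirror images
-- n − 1 − i = 1 + c + k + (k − 1 − i) all have cyclic norm 1 + i.
cycNorm-lower : ∀ c k i → i < k → cycNorm (suc (c + (k + k))) (suc i) ≡ suc i
cycNorm-lower c k i i<k = m≤n⇒m⊓n≡m (begin
  suc i               ≤⟨ i<k ⟩
  k                   ≤⟨ m≤n+m k c ⟩
  c + k               ≡⟨ m+n∸n≡m (c + k) k ⟨
  c + k + k ∸ k       ≤⟨ ∸-monoʳ-≤ (c + k + k) (<⇒≤ i<k) ⟩
  c + k + k ∸ i       ≡⟨ cong (_∸ i) (+-assoc c k k) ⟩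
  c + (k + k) ∸ i     ∎)
  where open ≤-Reasoning

cycNorm-upper : ∀ c k j → j < k → cycNorm (suc (c + (k + k))) (suc (c + (k + j))) ≡ suc (k ∸ suc j)
cycNorm-upper c k j j<k = begin
  suc (c + (k + j)) ⊓ (c + (k + k) ∸ (c + (k + j))) ≡⟨ cong (suc (c + (k + j)) ⊓_) complement ⟩
  suc (c + (k + j)) ⊓ (k ∸ j)                       ≡⟨ m≥n⇒m⊓n≡n k∸j≤ ⟩
  k ∸ j                                             ≡⟨ +-∸-assoc 1 j<k ⟩
  suc (k ∸ suc j)                                   ∎
  where
  open ≡-Reasoning
  complement : c + (k + k) ∸ (c + (k + j)) ≡ k ∸ j
  complement = trans ([m+n]∸[m+o]≡n∸o c (k + k) (k + j)) ([m+n]∸[m+o]≡n∸o k k j)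
  k∸j≤ : k ∸ j ≤ suc (c + (k + j))
  k∸j≤ = ≤-trans (m∸n≤m k j) (≤-trans (m≤m+n k j) (≤-trans (m≤n+m (k + j) c) (n≤1+n _)))

module _ (g : ℕ → ℕ) where

  sumBelow-cycNorm-lower : ∀ c k →
    sumBelow k (λ i → g (cycNorm (suc (c + (k + k))) (suc i))) ≡ sumBelow k (g ∘ suc)
  sumBelow-cycNorm-lower c k = sumBelow-cong k λ i i<k → cong g (cycNorm-lower c k i i<k)

  sumBelow-cycNorm-upper : ∀ c k →
    sumBelow k (λ j → g (cycNorm (suc (c + (k + k))) (suc (c + (k + j))))) ≡ sumBelow k (g ∘ suc)
  sumBelow-cycNorm-upper c k =
    trans (sumBelow-cong k λ j j<k → cong g (cycNorm-upper c k j j<k)) (sumBelow-reverse k (g ∘ suc))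

  sumBelow-cycNorm-odd : ∀ k → let S = sumBelow k (g ∘ suc) in
    sumBelow (suc (k + k)) (g ∘ cycNorm (suc (k + k))) ≡ g 0 + (S + S)
  sumBelow-cycNorm-odd k = cong (g 0 +_) (trans (sumBelow-+ k k _)
    (cong₂ _+_ (sumBelow-cycNorm-lower 0 k) (sumBelow-cycNorm-upper 0 k)))

  sumBelow-cycNorm-even : ∀ k → let S = sumBelow k (g ∘ suc) in
    sumBelow (suc (suc (k + k))) (g ∘ cycNorm (suc (suc (k + k)))) ≡ g 0 + (S + (g (suc k) + S))
  sumBelow-cycNorm-even k = cong (g 0 +_) (begin
    sumBelow (suc (k + k)) (h ∘ suc)          ≡⟨ cong (λ m → sumBelow m (h ∘ suc)) (+-suc k k) ⟨
    sumBelow (k + suc k) (h ∘ suc)            ≡⟨ sumBelow-+ k (suc k) (h ∘ suc) ⟩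
    sumBelow k (h ∘ suc) + (h (suc (k + 0)) + sumBelow k (λ j → h (suc (k + suc j))))
      ≡⟨ cong₂ _+_ (sumBelow-cycNorm-lower 1 k) (cong₂ _+_ middle upper) ⟩
    sumBelow k (g ∘ suc) + (g (suc k) + sumBelow k (g ∘ suc)) ∎)
    where
    open ≡-Reasoning
    h = g ∘ cycNorm (suc (suc (k + k)))
    upper : sumBelow k (λ j → h (suc (k + suc j))) ≡ sumBelow k (g ∘ suc)
    upper = trans (sumBelow-cong k λ j _ → cong (h ∘ suc) (+-suc k j)) (sumBelow-cycNorm-upper 1 k)
    middle : h (suc (k + 0)) ≡ g (suc k)
    middle = cong g (begin
      suc (k + 0) ⊓ (suc (k + k) ∸ (k + 0)) ≡⟨ cong (λ x → suc x ⊓ (suc (k + k) ∸ x)) (+-identityʳ k) ⟩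
      suc k ⊓ (suc (k + k) ∸ k)             ≡⟨ cong (suc k ⊓_) (trans (cong (_∸ k) (sym (+-suc k k))) (m+n∸m≡n k (suc k))) ⟩
      suc k ⊓ suc k                         ≡⟨ ⊓-idem (suc k) ⟩
      suc k                                 ∎)

even-or-odd : ∀ m → ∃ λ k → m ≡ k + k ⊎ m ≡ suc (k + k)
even-or-odd zero = 0 , inj₁ refl
even-or-odd (suc m) with even-or-odd m
... | k , inj₁ refl = k , inj₂ refl
... | k , inj₂ refl = suc k , inj₁ (cong suc (sym (+-suc k k)))

divFloor-+-* : ∀ a q d → a < d → divFloor (a + q * d) d ≡ q
divFloor-+-* a q (suc d) a<d = begin
  (a + q * suc d) / suc d            ≡⟨ +-distrib-/-∣ʳ a (n∣m*n q) ⟩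
  a / suc d + q * suc d / suc d      ≡⟨ cong₂ _+_ (m<n⇒m/n≡0 a<d) (m*n/n≡m q (suc d)) ⟩
  q                                  ∎
  where open ≡-Reasoning

-- The right-hand side of the theorem, with m = n − 1.
closedForm : ℕ → ℕ → ℕ
closedForm r m = (divFloor m (2 * r) + 1) * (m ∸ r * divFloor m (2 * r))

closedForm-≡ : ∀ {m} r a q → a < 2 * r → m ≡ a + q * (2 * r) → closedForm r m ≡ (q + 1) * (q * r + a)
closedForm-≡ r a q a<2r refl rewrite divFloor-+-* a q (2 * r) a<2r =
  cong ((q + 1) *_) (trans (cong (_∸ r * q) (rearrange r a q)) (m+n∸m≡n (r * q) (q * r + a)))
  where
  rearrange : ∀ r a q → a + q * (2 * r) ≡ r * q + (q * r + a)
  rearrange = solve-∀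

module _ (r : ℕ) .{{_ : NonZero r}} where

  ceilSum : ℕ → ℕ
  ceilSum m = sumBelow m (λ i → ⌈ suc i / r ⌉)

  ceilSum-qr+s : ∀ q s → s ≤ r → 2 * ceilSum (q * r + s) ≡ (q + 1) * (q * r + 2 * s)
  ceilSum-qr+s zero    zero    _ = refl
  ceilSum-qr+s (suc q) zero    _ = begin
    2 * ceilSum (suc q * r + 0)       ≡⟨ cong (λ m → 2 * ceilSum m) (trans (+-identityʳ _) (+-comm r (q * r))) ⟩
    2 * ceilSum (q * r + r)           ≡⟨ ceilSum-qr+s q r ≤-refl ⟩
    (q + 1) * (q * r + 2 * r)         ≡⟨ rearrange q r ⟩
    (suc q + 1) * (suc q * r + 2 * 0) ∎
    where
    open ≡-Reasoning
    rearrange : ∀ q r → (q + 1) * (q * r + 2 * r) ≡ (suc q + 1) * (suc q * r + 2 * 0)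
    rearrange = solve-∀
  ceilSum-qr+s q (suc s) s<r = begin
    2 * ceilSum (q * r + suc s)                         ≡⟨ cong (λ m → 2 * ceilSum m) (+-suc (q * r) s) ⟩
    2 * ceilSum (suc (q * r + s))                       ≡⟨ cong (2 *_) (sumBelow-suc (q * r + s) _) ⟩
    2 * (ceilSum (q * r + s) + ⌈ suc (q * r + s) / r ⌉) ≡⟨ *-distribˡ-+ 2 (ceilSum (q * r + s)) _ ⟩
    2 * ceilSum (q * r + s) + 2 * ⌈ suc (q * r + s) / r ⌉
      ≡⟨ cong₂ _+_ (ceilSum-qr+s q s (<⇒≤ s<r)) (cong (2 *_) (⌈[1+qr+s]/r⌉≡1+q q s r s<r)) ⟩
    (q + 1) * (q * r + 2 * s) + 2 * suc q               ≡⟨ rearrange q r s ⟩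
    (q + 1) * (q * r + 2 * suc s)                       ∎
    where
    open ≡-Reasoning
    rearrange : ∀ q r s → (q + 1) * (q * r + 2 * s) + 2 * suc q ≡ (q + 1) * (q * r + 2 * suc s)
    rearrange = solve-∀

  k≡[k/r]*r+k%r : ∀ k → k ≡ k / r * r + k % r
  k≡[k/r]*r+k%r k = trans (m≡m%n+[m/n]*n k r) (+-comm (k % r) _)

  2*ceilSum : ∀ k → 2 * ceilSum k ≡ (k / r + 1) * (k / r * r + 2 * (k % r))
  2*ceilSum k = trans (cong (λ m → 2 * ceilSum m) (k≡[k/r]*r+k%r k)) (ceilSum-qr+s (k / r) (k % r) (<⇒≤ (m%n<n k r)))

  ⌈[1+k]/r⌉ : ∀ k → ⌈ suc k / r ⌉ ≡ suc (k / r)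
  ⌈[1+k]/r⌉ k = trans (cong (λ x → ⌈ suc x / r ⌉) (k≡[k/r]*r+k%r k))
                      (⌈[1+qr+s]/r⌉≡1+q (k / r) (k % r) r (m%n<n k r))

  k+k≡2[k%r]+[k/r]*2r : ∀ k → k + k ≡ 2 * (k % r) + k / r * (2 * r)
  k+k≡2[k%r]+[k/r]*2r k = trans (cong (λ x → x + x) (m≡m%n+[m/n]*n k r)) (rearrange (k % r) (k / r) r)
    where
    rearrange : ∀ s q r → s + q * r + (s + q * r) ≡ 2 * s + q * (2 * r)
    rearrange = solve-∀

  transmission-circAdj-odd : ∀ k (v : Fin (suc (k + k))) → transmission (circAdj (suc (k + k)) r) v ≡ 2 * ceilSum k
  transmission-circAdj-odd k v = begin
    transmission (circAdj (suc (k + k)) r) v                       ≡⟨ transmission-circAdj r v ⟩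
    sumBelow (suc (k + k)) (λ d → ⌈ cycNorm (suc (k + k)) d / r ⌉) ≡⟨ sumBelow-cycNorm-odd (λ d → ⌈ d / r ⌉) k ⟩
    ⌈ 0 / r ⌉ + (ceilSum k + ceilSum k)                            ≡⟨ cong (_+ (ceilSum k + ceilSum k)) (⌈0/r⌉≡0 r) ⟩
    ceilSum k + ceilSum k                                          ≡⟨ cong (ceilSum k +_) (+-identityʳ _) ⟨
    2 * ceilSum k                                                  ∎
    where open ≡-Reasoning

  transmission-circAdj-even : ∀ k (v : Fin (suc (suc (k + k)))) →
    transmission (circAdj (suc (suc (k + k))) r) v ≡ 2 * ceilSum k + ⌈ suc k / r ⌉
  transmission-circAdj-even k v = begin
    transmission (circAdj n r) v                 ≡⟨ transmission-circAdj r v ⟩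
    sumBelow n (λ d → ⌈ cycNorm n d / r ⌉)       ≡⟨ sumBelow-cycNorm-even (λ d → ⌈ d / r ⌉) k ⟩
    ⌈ 0 / r ⌉ + (ceilSum k + (M + ceilSum k))    ≡⟨ cong (_+ (ceilSum k + (M + ceilSum k))) (⌈0/r⌉≡0 r) ⟩
    ceilSum k + (M + ceilSum k)                  ≡⟨ rearrange (ceilSum k) M ⟩
    2 * ceilSum k + M                            ∎
    where
    open ≡-Reasoning
    n = suc (suc (k + k))
    M = ⌈ suc k / r ⌉
    rearrange : ∀ S M → S + (M + S) ≡ 2 * S + M
    rearrange = solve-∀

  transmission-circAdj-closedForm : ∀ m (v : Fin (suc m)) → transmission (circAdj (suc m) r) v ≡ closedForm r m
  transmission-circAdj-closedForm m v with even-or-odd m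
  ... | k , inj₁ refl = begin
    transmission (circAdj (suc (k + k)) r) v ≡⟨ transmission-circAdj-odd k v ⟩
    2 * ceilSum k                            ≡⟨ 2*ceilSum k ⟩
    (q + 1) * (q * r + 2 * s)                ≡⟨ closedForm-≡ r (2 * s) q 2s<2r (k+k≡2[k%r]+[k/r]*2r k) ⟨
    closedForm r (k + k)                     ∎
    where
    open ≡-Reasoning
    q = k / r
    s = k % r
    2s<2r : 2 * s < 2 * r
    2s<2r = *-monoʳ-< 2 (m%n<n k r)
  ... | k , inj₂ refl = begin
    transmission (circAdj (suc (suc (k + k))) r) v ≡⟨ transmission-circAdj-even k v ⟩
    2 * ceilSum k + ⌈ suc k / r ⌉                  ≡⟨ cong₂ _+_ (2*ceilSum k) (⌈[1+k]/r⌉ k) ⟩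
    (q + 1) * (q * r + 2 * s) + suc q              ≡⟨ rearrange q r s ⟩
    (q + 1) * (q * r + suc (2 * s))
      ≡⟨ closedForm-≡ r (suc (2 * s)) q 1+2s<2r (cong suc (k+k≡2[k%r]+[k/r]*2r k)) ⟨
    closedForm r (suc (k + k))                     ∎
    where
    open ≡-Reasoning
    q = k / r
    s = k % r
    1+2s<2r : suc (2 * s) < 2 * r
    1+2s<2r = subst (_≤ 2 * r) (*-suc 2 s) (*-monoʳ-≤ 2 (m%n<n k r))
    rearrange : ∀ q r s → (q + 1) * (q * r + 2 * s) + suc q ≡ (q + 1) * (q * r + suc (2 * s))
    rearrange = solve-∀

  2∣size*transmission : ∀ m → 2 ∣ suc m * transmission (circAdj (suc m) r) Fin.zero
  2∣size*transmission m with even-or-odd m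
  ... | k , inj₁ refl = subst (λ t → 2 ∣ suc (k + k) * t) (sym (transmission-circAdj-odd k Fin.zero))
                          (∣n⇒∣m*n (suc (k + k)) (m∣m*n (ceilSum k)))
  ... | k , inj₂ refl = ∣m⇒∣m*n (transmission (circAdj (suc (suc (k + k))) r) Fin.zero) (divides (suc k) (rearrange k))
    where
    rearrange : ∀ k → suc (suc (k + k)) ≡ suc k * 2
    rearrange = solve-∀

wiener-regular : ∀ {n} (G : Fin n → Fin n → Bool) {t} → (∀ v → transmission G v ≡ t) → 2 ∣ n * t →
                 ∀ v → 2 * wiener G ≡ n * transmission G v
wiener-regular {n} G {t} regular 2∣nt v = begin
  2 * wiener G         ≡⟨ cong (λ x → 2 * (x / 2)) (trans (sum-map-allFin n regular) (sumBelow-const n t)) ⟩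
  2 * (n * t / 2)      ≡⟨ m*[n/m]≡n 2∣nt ⟩
  n * t                ≡⟨ cong (n *_) (regular v) ⟨
  n * transmission G v ∎
  where open ≡-Reasoning

wiener-circAdj : ∀ m r .{{_ : NonZero r}} (v : Fin (suc m)) →
                 2 * wiener (circAdj (suc m) r) ≡ suc m * transmission (circAdj (suc m) r) v
wiener-circAdj m r = wiener-regular (circAdj (suc m) r) {t = transmission (circAdj (suc m) r) Fin.zero}
  (λ v → trans (transmission-circAdj r v) (sym (transmission-circAdj r (Fin.zero {m})))) (2∣size*transmission r m)

corollary4p6 : (n r : ℕ) → 3 ≤ n → 1 ≤ r → r ≤ n / 2 →
    ((v : Fin n) → 2 * wiener (circAdj n r) ≡ n * transmission (circAdj n r) v)
    × ((v : Fin n) → transmission (circAdj n r) v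
         ≡ (divFloor (n ∸ 1) (2 * r) + 1) * ((n ∸ 1) ∸ r * divFloor (n ∸ 1) (2 * r)))
corollary4p6 (suc m) r@(suc _) _ _ _ = wiener-circAdj m r , transmission-circAdj-closedForm r m
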